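{- Let $G$ be a graph on $n$ vertices $v_1,\dots,v_n$, let $0\leq k\leq n$ be an integer, and write $G_i=G-v_i$. For $0\leq t\leq n-1$ let $s_t=\sum_{i=1}^{n-k}d_t(G_i)$ be the total number of vertices of degree $t$ seen in the cards $G_1,\dots,G_{n-k}$, and let $$\varepsilon_t=(n-1-t)d_t+(t+1)d_{t+1}-s_t,$$ where $d_t=d_t(G)$. Then $0\leq\varepsilon_t\leq k(d_t+d_{t+1})$.
   Context: All graphs are finite, simple and undirected. For a graph $G'$ and integer $t$, $d_t(G')=|\{v\in V(G'):d_{G'}(v)=t\}|$ is the number of vertices of degree $t$ in $G'$ (so $d_n(G)=0$ for $G$ on $n$ vertices). $G-v$ is the graph obtained from $G$ by deleting $v$ and all incident edges. -}

module Defs where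

open import Data.Bool using (Bool; true; false; if_then_else_)
open import Data.Nat using (ℕ; zero; suc; _+_; _<ᵇ_)
open import Data.Fin using (Fin; zero; suc; toℕ; punchIn)
open import Relation.Binary.PropositionalEquality using (_≡_)

record Graph (n : ℕ) : Set where
  field
    adj   : Fin n → Fin n → Bool
    sym   : ∀ u v → adj u v ≡ adj v u
    irrefl : ∀ v → adj v v ≡ false
open Graph public

countFin : ∀ {n} → (Fin n → Bool) → ℕ
countFin {zero}  p = 0
countFin {suc n} p = (if p zero then 1 else 0) + countFin (λ x → p (suc x))

sumFin : ∀ {n} → (Fin n → ℕ) → ℕ
sumFin {zero}  f = 0
sumFin {suc n} f = f zero + sumFin (λ x → f (suc x))

deg : ∀ {n} → Graph n → Fin n → ℕ
deg G v = countFin (adj G v)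

dd : ∀ {n} → Graph n → ℕ → ℕ
dd G t = countFin (λ v → (deg G v Data.Nat.≡ᵇ t))

delete : ∀ {m} → Graph (suc m) → Fin (suc m) → Graph m
delete G i = record
  { adj    = λ u v → adj G (punchIn i u) (punchIn i v)
  ; sym    = λ u v → sym G (punchIn i u) (punchIn i v)
  ; irrefl = λ v → irrefl G (punchIn i v)
  }

-- s_t = Σ_{i = 1}^{N} d_t(G - v_i), where v_1,…,v_{suc m} are the vertices
-- 0,…,m of Fin (suc m) (v_j = vertex j-1), i.e. sum over vertices with index < N.
sCards : ∀ {m} → Graph (suc m) → ℕ → ℕ → ℕ
sCards G N t = sumFin (λ i → if toℕ i <ᵇ N then dd (delete G i) t else 0)

-- Double counting the pairs (vᵢ, u) with u ≠ vᵢ and deg_{G - vᵢ}(u) = t: a vertex of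
-- degree t is counted once for each of its n - 1 - t non-neighbours, a vertex of degree
-- t + 1 once for each of its t + 1 neighbours, and no other vertex is counted. Hence the
-- sum over all n cards is exactly (n - 1 - t) d_t + (t + 1) d_{t+1}. Every vertex of degree
-- t in a card had degree t or t + 1 in G, so each card contributes at most d_t + d_{t+1};
-- the k omitted cards therefore account for between 0 and k (d_t + d_{t+1}).
module Submission where

open import Defs hiding (sym)
open import Data.Bool.Base using (Bool; true; false; not; if_then_else_; T)
open import Data.Fin.Base using (Fin; zero; suc; toℕ; punchIn)
open import Data.Nat.Base
open import Data.Nat.Properties
open import Data.Product.Base using (_×_; _,_)
open import Data.Unit.Base using (tt)
open import Function.Base using (_∘_)
open import Relation.Binary.PropositionalEquality
open import Algebra.Properties.Semiring.Sum +-*-semiring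
  using (sum; sum-cong-≗; ∑-distrib-+; ∑-comm; sum-remove; *-distribʳ-sum)
open import Algebra.Properties.CommutativeSemigroup +-commutativeSemigroup
  using (x∙yz≈y∙xz)

𝟙 : Bool → ℕ
𝟙 b = if b then 1 else 0

sumFin≡sum : ∀ {n} (f : Fin n → ℕ) → sumFin f ≡ sum f
sumFin≡sum {zero}  f = refl
sumFin≡sum {suc n} f = cong (f zero +_) (sumFin≡sum (f ∘ suc))

countFin≡sum : ∀ {n} (p : Fin n → Bool) → countFin p ≡ sum (𝟙 ∘ p)
countFin≡sum {zero}  p = refl
countFin≡sum {suc n} p = cong (𝟙 (p zero) +_) (countFin≡sum (p ∘ suc))

countFin-not+countFin : ∀ {n} (p : Fin n → Bool) → countFin (not ∘ p) + countFin p ≡ n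
countFin-not+countFin {zero}  p = refl
countFin-not+countFin {suc n} p with p zero
... | true  = trans (+-suc _ _) (cong suc (countFin-not+countFin (p ∘ suc)))
... | false = cong suc (countFin-not+countFin (p ∘ suc))

sum-mono-≤ : ∀ {n} {f g : Fin n → ℕ} → (∀ i → f i ≤ g i) → sum f ≤ sum g
sum-mono-≤ {zero}  f≤g = z≤n
sum-mono-≤ {suc n} f≤g = +-mono-≤ (f≤g zero) (sum-mono-≤ (f≤g ∘ suc))

sum-prefix≤sum : ∀ {n} N (f : Fin n → ℕ) →
  sum (λ i → if toℕ i <ᵇ N then f i else 0) ≤ sum f
sum-prefix≤sum N f = sum-mono-≤ prefix≤
  where
  prefix≤ : ∀ i → (if toℕ i <ᵇ N then f i else 0) ≤ f i
  prefix≤ i with toℕ i <ᵇ N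
  ... | true  = ≤-refl
  ... | false = z≤n

sum≤sum-prefix+ : ∀ {n} N {B} (f : Fin n → ℕ) → (∀ i → f i ≤ B) →
  sum f ≤ sum (λ i → if toℕ i <ᵇ N then f i else 0) + (n ∸ N) * B
sum≤sum-prefix+ {zero}  N       f f≤B = z≤n
sum≤sum-prefix+ {suc n} zero {B} f f≤B = begin
  f zero + sum (f ∘ suc)          ≤⟨ +-mono-≤ (f≤B zero) (sum≤sum-prefix+ zero (f ∘ suc) (f≤B ∘ suc)) ⟩
  B + (prefix + n * B)            ≡⟨ x∙yz≈y∙xz B prefix (n * B) ⟩
  prefix + (B + n * B)            ∎
  where
  open ≤-Reasoning
  prefix : ℕ
  prefix = sum (λ (i : Fin n) → 0)
sum≤sum-prefix+ {suc n} (suc N) {B} f f≤B = begin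
  f zero + sum (f ∘ suc)          ≤⟨ +-monoʳ-≤ (f zero) (sum≤sum-prefix+ N (f ∘ suc) (f≤B ∘ suc)) ⟩
  f zero + (prefix + (n ∸ N) * B) ≡⟨ +-assoc (f zero) prefix _ ⟨
  f zero + prefix + (n ∸ N) * B   ∎
  where
  open ≤-Reasoning
  prefix : ℕ
  prefix = sum (λ i → if toℕ i <ᵇ N then f (suc i) else 0)

+-cancelʳ-≡ᵇ : ∀ a b c → (a + c ≡ᵇ b + c) ≡ (a ≡ᵇ b)
+-cancelʳ-≡ᵇ a b zero    rewrite +-identityʳ a | +-identityʳ b = refl
+-cancelʳ-≡ᵇ a b (suc c) rewrite +-suc a c | +-suc b c = +-cancelʳ-≡ᵇ a b c

𝟙-≡ᵇ-*-subst : ∀ a b (f : ℕ → ℕ) → 𝟙 (a ≡ᵇ b) * f a ≡ 𝟙 (a ≡ᵇ b) * f b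
𝟙-≡ᵇ-*-subst a b f with a ≡ᵇ b in eq
... | true  = cong (λ x → 1 * f x) (≡ᵇ⇒≡ a b (subst T (sym eq) tt))
... | false = refl

𝟙-≡ᵇ-+-𝟙 : ∀ d t a → 𝟙 (d ≡ᵇ t + 𝟙 a) ≡ 𝟙 (not a) * 𝟙 (d ≡ᵇ t) + 𝟙 a * 𝟙 (d ≡ᵇ t + 1)
𝟙-≡ᵇ-+-𝟙 d t true  = sym (+-identityʳ _)
𝟙-≡ᵇ-+-𝟙 d t false rewrite +-identityʳ t = sym (trans (+-identityʳ _) (+-identityʳ _))

𝟙-≡ᵇ-+-𝟙-≤ : ∀ d t a → 𝟙 (d ≡ᵇ t + 𝟙 a) ≤ 𝟙 (d ≡ᵇ t) + 𝟙 (d ≡ᵇ t + 1)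
𝟙-≡ᵇ-+-𝟙-≤ d t true  = m≤n+m _ _
𝟙-≡ᵇ-+-𝟙-≤ d t false rewrite +-identityʳ t = m≤m+n _ _

deg-delete : ∀ {m} (G : Graph (suc m)) i v →
  deg (delete G i) v + 𝟙 (adj G (punchIn i v) i) ≡ deg G (punchIn i v)
deg-delete G i v = begin
  deg (delete G i) v + 𝟙 (adj G u i)                 ≡⟨ +-comm _ (𝟙 (adj G u i)) ⟩
  𝟙 (adj G u i) + countFin (adj G u ∘ punchIn i)     ≡⟨ cong (𝟙 (adj G u i) +_) (countFin≡sum (adj G u ∘ punchIn i)) ⟩
  𝟙 (adj G u i) + sum (𝟙 ∘ adj G u ∘ punchIn i)      ≡⟨ sum-remove (𝟙 ∘ adj G u) ⟨
  sum (𝟙 ∘ adj G u)                                  ≡⟨ countFin≡sum (adj G u) ⟨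
  deg G u                                            ∎
  where
  open ≡-Reasoning
  u = punchIn i v

module DegreeCounting {m} (G : Graph (suc m)) (t : ℕ) where

  n : ℕ
  n = suc m

  -- For u ≠ i: u has degree t in G - vᵢ. On the diagonal (by irreflexivity): deg vᵢ = t,
  -- which makes every column sum depend only on deg u.
  counted : Fin n → Fin n → Bool
  counted i u = deg G u ≡ᵇ t + 𝟙 (adj G u i)

  dd-delete : ∀ i → dd (delete G i) t ≡ sum (𝟙 ∘ counted i ∘ punchIn i)
  dd-delete i = trans (countFin≡sum (λ v → deg (delete G i) v ≡ᵇ t)) (sum-cong-≗ λ v → cong 𝟙 (begin
    deg (delete G i) v ≡ᵇ t                         ≡⟨ +-cancelʳ-≡ᵇ (deg (delete G i) v) t (𝟙 (adj G (punchIn i v) i)) ⟨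
    deg (delete G i) v + 𝟙 (adj G (punchIn i v) i)
      ≡ᵇ t + 𝟙 (adj G (punchIn i v) i)              ≡⟨ cong (_≡ᵇ t + 𝟙 (adj G (punchIn i v) i)) (deg-delete G i v) ⟩
    counted i (punchIn i v)                         ∎))
    where open ≡-Reasoning

  row-sum : ∀ i → sum (𝟙 ∘ counted i) ≡ 𝟙 (deg G i ≡ᵇ t) + dd (delete G i) t
  row-sum i = begin
    sum (𝟙 ∘ counted i)                                      ≡⟨ sum-remove (𝟙 ∘ counted i) ⟩
    𝟙 (counted i i) + sum (𝟙 ∘ counted i ∘ punchIn i)        ≡⟨ cong₂ _+_ diagonal (dd-delete i) ⟨
    𝟙 (deg G i ≡ᵇ t) + dd (delete G i) t                     ∎
    where
    open ≡-Reasoning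
    diagonal : 𝟙 (deg G i ≡ᵇ t) ≡ 𝟙 (counted i i)
    diagonal rewrite irrefl G i | +-identityʳ t = refl

  column-sum : ∀ u → sum (λ i → 𝟙 (counted i u)) ≡
    𝟙 (deg G u ≡ᵇ t) * (n ∸ t) + 𝟙 (deg G u ≡ᵇ t + 1) * (t + 1)
  column-sum u = begin
    sum (λ i → 𝟙 (counted i u))
      ≡⟨ sum-cong-≗ (λ i → 𝟙-≡ᵇ-+-𝟙 (deg G u) t (adj G u i)) ⟩
    sum (λ i → 𝟙 (not (adj G u i)) * X + 𝟙 (adj G u i) * Y)
      ≡⟨ ∑-distrib-+ (λ i → 𝟙 (not (adj G u i)) * X) (λ i → 𝟙 (adj G u i) * Y) ⟩
    sum (λ i → 𝟙 (not (adj G u i)) * X) + sum (λ i → 𝟙 (adj G u i) * Y)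
      ≡⟨ cong₂ _+_ (*-distribʳ-sum X (𝟙 ∘ not ∘ adj G u)) (*-distribʳ-sum Y (𝟙 ∘ adj G u)) ⟨
    sum (𝟙 ∘ not ∘ adj G u) * X + sum (𝟙 ∘ adj G u) * Y
      ≡⟨ cong₂ (λ a b → a * X + b * Y) (countFin≡sum (not ∘ adj G u)) (countFin≡sum (adj G u)) ⟨
    countFin (not ∘ adj G u) * X + deg G u * Y
      ≡⟨ cong (λ a → a * X + deg G u * Y) non-neighbours ⟩
    (n ∸ deg G u) * X + deg G u * Y
      ≡⟨ cong₂ _+_ (*-comm _ X) (*-comm _ Y) ⟩
    X * (n ∸ deg G u) + Y * deg G u
      ≡⟨ cong₂ _+_ (𝟙-≡ᵇ-*-subst (deg G u) t (n ∸_)) (𝟙-≡ᵇ-*-subst (deg G u) (t + 1) (λ d → d)) ⟩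
    X * (n ∸ t) + Y * (t + 1) ∎
    where
    open ≡-Reasoning
    X = 𝟙 (deg G u ≡ᵇ t)
    Y = 𝟙 (deg G u ≡ᵇ t + 1)
    non-neighbours : countFin (not ∘ adj G u) ≡ n ∸ deg G u
    non-neighbours = trans (sym (m+n∸n≡m _ (deg G u)))
                           (cong (_∸ deg G u) (countFin-not+countFin (adj G u)))

  dd+sum-cards : dd G t + sum (λ i → dd (delete G i) t) ≡ (n ∸ t) * dd G t + (t + 1) * dd G (t + 1)
  dd+sum-cards = begin
    dd G t + sum (λ i → dd (delete G i) t)
      ≡⟨ cong (_+ sum (λ i → dd (delete G i) t)) (countFin≡sum (λ v → deg G v ≡ᵇ t)) ⟩
    sum X + sum (λ i → dd (delete G i) t)
      ≡⟨ ∑-distrib-+ X (λ i → dd (delete G i) t) ⟨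
    sum (λ i → X i + dd (delete G i) t)
      ≡⟨ sum-cong-≗ row-sum ⟨
    sum (λ i → sum (λ u → 𝟙 (counted i u)))
      ≡⟨ ∑-comm (λ i u → 𝟙 (counted i u)) ⟩
    sum (λ u → sum (λ i → 𝟙 (counted i u)))
      ≡⟨ sum-cong-≗ column-sum ⟩
    sum (λ u → X u * (n ∸ t) + Y u * (t + 1))
      ≡⟨ ∑-distrib-+ (λ u → X u * (n ∸ t)) (λ u → Y u * (t + 1)) ⟩
    sum (λ u → X u * (n ∸ t)) + sum (λ u → Y u * (t + 1))
      ≡⟨ cong₂ _+_ (*-distribʳ-sum (n ∸ t) X) (*-distribʳ-sum (t + 1) Y) ⟨
    sum X * (n ∸ t) + sum Y * (t + 1)
      ≡⟨ cong₂ _+_ (*-comm (sum X) _) (*-comm (sum Y) _) ⟩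
    (n ∸ t) * sum X + (t + 1) * sum Y
      ≡⟨ cong₂ (λ a b → (n ∸ t) * a + (t + 1) * b)
               (countFin≡sum (λ v → deg G v ≡ᵇ t)) (countFin≡sum (λ v → deg G v ≡ᵇ t + 1)) ⟨
    (n ∸ t) * dd G t + (t + 1) * dd G (t + 1) ∎
    where
    open ≡-Reasoning
    X Y : Fin n → ℕ
    X u = 𝟙 (deg G u ≡ᵇ t)
    Y u = 𝟙 (deg G u ≡ᵇ t + 1)

  sum-cards : t < n → sum (λ i → dd (delete G i) t) ≡ (m ∸ t) * dd G t + (t + 1) * dd G (t + 1)
  sum-cards (s≤s t≤m) = +-cancelˡ-≡ (dd G t) _ _ (begin
    dd G t + sum (λ i → dd (delete G i) t)              ≡⟨ dd+sum-cards ⟩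
    (n ∸ t) * dd G t + (t + 1) * dd G (t + 1)           ≡⟨ cong (λ a → a * dd G t + (t + 1) * dd G (t + 1)) (+-∸-assoc 1 t≤m) ⟩
    (1 + (m ∸ t)) * dd G t + (t + 1) * dd G (t + 1)     ≡⟨ +-assoc (dd G t) _ _ ⟩
    dd G t + ((m ∸ t) * dd G t + (t + 1) * dd G (t + 1)) ∎)
    where open ≡-Reasoning

  dd-delete≤ : ∀ i → dd (delete G i) t ≤ dd G t + dd G (t + 1)
  dd-delete≤ i = begin
    dd (delete G i) t                                         ≤⟨ m≤n+m _ _ ⟩
    𝟙 (deg G i ≡ᵇ t) + dd (delete G i) t                      ≡⟨ row-sum i ⟨
    sum (𝟙 ∘ counted i)                                       ≤⟨ sum-mono-≤ (λ u → 𝟙-≡ᵇ-+-𝟙-≤ (deg G u) t (adj G u i)) ⟩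
    sum (λ u → 𝟙 (deg G u ≡ᵇ t) + 𝟙 (deg G u ≡ᵇ t + 1))       ≡⟨ ∑-distrib-+ (λ u → 𝟙 (deg G u ≡ᵇ t)) (λ u → 𝟙 (deg G u ≡ᵇ t + 1)) ⟩
    sum (λ u → 𝟙 (deg G u ≡ᵇ t)) + sum (λ u → 𝟙 (deg G u ≡ᵇ t + 1))
      ≡⟨ cong₂ _+_ (countFin≡sum (λ v → deg G v ≡ᵇ t)) (countFin≡sum (λ v → deg G v ≡ᵇ t + 1)) ⟨
    dd G t + dd G (t + 1)                                     ∎
    where open ≤-Reasoning

lemma4 : ∀ (m : ℕ) (G : Graph (suc m)) (k t : ℕ) → k ≤ suc m → t < suc m →
    (sCards G (suc m ∸ k) t ≤ (m ∸ t) * dd G t + (t + 1) * dd G (t + 1))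
    × ((m ∸ t) * dd G t + (t + 1) * dd G (t + 1) ≤ sCards G (suc m ∸ k) t + k * (dd G t + dd G (t + 1)))
lemma4 m G k t k≤n t<n = lower , upper
  where
  open DegreeCounting G t
  open ≤-Reasoning
  N : ℕ
  N = suc m ∸ k
  card : Fin (suc m) → ℕ
  card i = dd (delete G i) t
  first-cards : ℕ
  first-cards = sum (λ i → if toℕ i <ᵇ N then card i else 0)

  lower : sCards G N t ≤ (m ∸ t) * dd G t + (t + 1) * dd G (t + 1)
  lower = begin
    sCards G N t                                  ≡⟨ sumFin≡sum (λ i → if toℕ i <ᵇ N then card i else 0) ⟩
    first-cards                                   ≤⟨ sum-prefix≤sum N card ⟩
    sum card                                      ≡⟨ sum-cards t<n ⟩
    (m ∸ t) * dd G t + (t + 1) * dd G (t + 1)     ∎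

  upper : (m ∸ t) * dd G t + (t + 1) * dd G (t + 1) ≤ sCards G N t + k * (dd G t + dd G (t + 1))
  upper = begin
    (m ∸ t) * dd G t + (t + 1) * dd G (t + 1)     ≡⟨ sum-cards t<n ⟨
    sum card                                      ≤⟨ sum≤sum-prefix+ N card dd-delete≤ ⟩
    first-cards + (suc m ∸ N) * (dd G t + dd G (t + 1))
      ≡⟨ cong₂ (λ a b → a + b * (dd G t + dd G (t + 1))) (sym (sumFin≡sum (λ i → if toℕ i <ᵇ N then card i else 0))) (m∸[m∸n]≡n k≤n) ⟩
    sCards G N t + k * (dd G t + dd G (t + 1))    ∎
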